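{- In the game $G_{\mathbb O}$ described in the context, there exists a strategy $\mathcal S_{\mathsf{MIN}}$ winning for the player $P_{\mathsf{MIN}}$; that is, whatever legal moves the players $P_{\mathsf{IND}}$ and $P_{\mathsf{PHP}}$ make, the resulting relation $\triangleleft$ is a strict linear ordering of $[0,\dots,n)$ with no least element.
   Context: Setup: $\mathbb M$ is a countable nonstandard model of true arithmetic (the complete theory of the standard natural numbers) in the language $\{0,1,+,\cdot,|\cdot|,\lfloor\cdot/2\rfloor,\#,\le\}$, where $|x|$ is bit length and $x\#y=2^{|x|\cdot|y|}$. Fix a nonstandard $n\in\mathbb M$; $[0,\dots,n)=\{0,\dots,n-1\}$. $\mathbb I$ is the substructure of $\mathbb M$ with domain $\{m:m\le 2^{|n|^c}$ for some standard $c\}$. "Definable" means definable in $\mathbb M$ with parameters. Conditions: $\mathbb O$ is the set of sequences (elements of $\mathbb M$) of distinct numbers from $[0,\dots,n)$ of length at most $|n|^c$ for some standard $c$. Each $o\in\mathbb O$ induces a strict order $\triangleleft_o$ whose domain $\mathrm{el}(o)$ is the set of entries of $o$, ordered in the order in which they are listed. $o'$ extends $o$, written $o'\preceq o$, if $\triangleleft_{o'}\supseteq\triangleleft_o$. Game $G_{\mathbb O}$: three players $P_{\mathsf{MIN}},P_{\mathsf{IND}},P_{\mathsf{PHP}}$ play countably many stages; $P_{\mathsf{MIN}}$ plays at stages $k\equiv0$, $P_{\mathsf{IND}}$ at $k\equiv1$, $P_{\mathsf{PHP}}$ at $k\equiv2\pmod 3$. $o_0$ is the empty sequence; at stage $k$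 the player receives $o_k\in\mathbb O$ and chooses $o_{k+1}\in\mathbb O$ with $o_{k+1}\preceq o_k$. A strategy is a (not necessarily definable) function $\mathcal S:\mathbb O\to\mathbb O$ with $\mathcal S(o)\preceq o$. A play yields the relation $\triangleleft=\bigcup_i\triangleleft_{o_i}$ on $\mathbb I$. A strategy for $P_{\mathsf{MIN}}$ is winning if the resulting $\triangleleft$ is a strict linear order of $[0,\dots,n)$ with no least element regardless of how the other players play. -}

module Defs where

open import Data.Nat as ℕ using (ℕ; zero; suc; ⌊_/2⌋; _%_)
open import Data.Nat.Logarithm using (⌈log₂_⌉)
open import Data.Product using (Σ; ∃; _×_; _,_)
open import Data.Sum using (_⊎_)
open import Data.Empty using (⊥)
open import Data.Unit using (⊤)
open import Relation.Nullary using (¬_)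
open import Relation.Binary.PropositionalEquality using (_≡_; _≢_)

record Structure : Set₁ where
  field
    Carrier : Set
    zer one : Carrier
    _⊕_ _⊗_ _♯_ : Carrier → Carrier → Carrier
    bitlen half : Carrier → Carrier
    _≼_ : Carrier → Carrier → Set

∣_∣ℕ : ℕ → ℕ
∣ x ∣ℕ = ⌈log₂ suc x ⌉

ℕ-str : Structure
ℕ-str = record
  { Carrier = ℕ ; zer = 0 ; one = 1 ; _⊕_ = ℕ._+_ ; _⊗_ = ℕ._*_
  ; _♯_ = λ x y → 2 ℕ.^ (∣ x ∣ℕ ℕ.* ∣ y ∣ℕ)
  ; bitlen = ∣_∣ℕ ; half = ⌊_/2⌋ ; _≼_ = ℕ._≤_ }

data Term : Set where
  var : ℕ → Term
  `0 `1 : Term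
  _`+_ _`*_ _`#_ : Term → Term → Term
  `len `half : Term → Term

data Formula : Set where
  _`=_ _`≤_ : Term → Term → Formula
  `⊤ `⊥ : Formula
  `¬_ : Formula → Formula
  _`∧_ _`∨_ _`⇒_ : Formula → Formula → Formula
  `∀ `∃ : Formula → Formula

module _ (𝔄 : Structure) where
  open Structure 𝔄

  Env : Set
  Env = ℕ → Carrier

  _∷ₑ_ : Carrier → Env → Env
  (a ∷ₑ ρ) zero = a
  (a ∷ₑ ρ) (suc i) = ρ i

  evalT : Env → Term → Carrier
  evalT ρ (var i) = ρ i
  evalT ρ `0 = zer
  evalT ρ `1 = one
  evalT ρ (s `+ t) = evalT ρ s ⊕ evalT ρ t
  evalT ρ (s `* t) = evalT ρ s ⊗ evalT ρ t
  evalT ρ (s `# t) = evalT ρ s ♯ evalT ρ t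
  evalT ρ (`len t) = bitlen (evalT ρ t)
  evalT ρ (`half t) = half (evalT ρ t)

  Sat : Env → Formula → Set
  Sat ρ (s `= t) = evalT ρ s ≡ evalT ρ t
  Sat ρ (s `≤ t) = evalT ρ s ≼ evalT ρ t
  Sat ρ `⊤ = ⊤
  Sat ρ `⊥ = ⊥
  Sat ρ (`¬ φ) = ¬ Sat ρ φ
  Sat ρ (φ `∧ ψ) = Sat ρ φ × Sat ρ ψ
  Sat ρ (φ `∨ ψ) = Sat ρ φ ⊎ Sat ρ ψ
  Sat ρ (φ `⇒ ψ) = Sat ρ φ → Sat ρ ψ
  Sat ρ (`∀ φ) = (a : Carrier) → Sat (a ∷ₑ ρ) φ
  Sat ρ (`∃ φ) = Σ Carrier λ a → Sat (a ∷ₑ ρ) φ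

  -- truth of the universal closure of φ
  Valid : Formula → Set
  Valid φ = (ρ : Env) → Sat ρ φ

ModelOfTrueArithmetic : Structure → Set
ModelOfTrueArithmetic 𝕄 = (φ : Formula) → Valid ℕ-str φ → Valid 𝕄 φ

Countable : Structure → Set
Countable 𝕄 = Σ (ℕ → Structure.Carrier 𝕄) Surjective′
  where Surjective′ = λ f → (a : Structure.Carrier 𝕄) → ∃ λ k → f k ≡ a

module InModel (𝕄 : Structure) where
  open Structure 𝕄

  M : Set
  M = Carrier

  _<_ : M → M → Set
  a < b = (a ≼ b) × (a ≢ b)

  numeral : ℕ → M
  numeral zero = zer
  numeral (suc k) = numeral k ⊕ one

  Nonstandard : M → Set
  Nonstandard x = (k : ℕ) → x ≢ numeral k

  _^ˢ_ : M → ℕ → M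
  x ^ˢ zero = one
  x ^ˢ suc c = (x ^ˢ c) ⊗ x

  _∣_ : M → M → Set
  d ∣ p = ∃ λ e → d ⊗ e ≡ p

  -- p = 2^k  (p is a power of two of bit length k+1)
  Exp2 : M → M → Set
  Exp2 k p = ((d : M) → d ∣ p → (d ≡ one) ⊎ (∃ λ e → d ≡ e ⊕ e)) × (bitlen p ≡ k ⊕ one)

  -- Cantor pairing: o = ⟨l , c⟩
  Pair : M → M → M → Set
  Pair l c o = o ⊕ o ≡ ((l ⊕ c) ⊗ ((l ⊕ c) ⊕ one)) ⊕ (c ⊕ c)

  module WithN (n : M) where
    W : M
    W = bitlen n

    -- v is the i-th block of W bits of c, i.e. v = ⌊c / 2^(W·i)⌋ mod 2^W
    Block : M → M → M → Set
    Block c i v = ∃ λ p → ∃ λ q → ∃ λ s → ∃ λ t → ∃ λ u →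
      Exp2 (W ⊗ i) p × Exp2 W q × (c ≡ (s ⊗ p) ⊕ t) × (t < p) × (s ≡ (u ⊗ q) ⊕ v) × (v < q)

    -- o codes a sequence of length l whose i-th entry (i < l) is Block c i
    IsSeq : M → M → M → Set
    IsSeq o l c = Pair l c o × ∃ λ p → Exp2 (W ⊗ l) p × (c < p)

    IsO : M → Set
    IsO o = ∃ λ l → ∃ λ c → IsSeq o l c
      × ((i j v : M) → i < l → j < l → Block c i v → Block c j v → i ≡ j)
      × ((i v : M) → i < l → Block c i v → v < n)
      × ∃ λ (e : ℕ) → l ≼ (W ^ˢ e)

    _◁[_]_ : M → M → M → Set
    a ◁[ o ] b = ∃ λ l → ∃ λ c → ∃ λ i → ∃ λ j →
      IsSeq o l c × i < j × j < l × Block c i a × Block c j b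

    _⪯_ : M → M → Set
    o′ ⪯ o = (a b : M) → a ◁[ o ] b → a ◁[ o′ ] b

    IsEmptySeq : M → Set
    IsEmptySeq o = IsSeq o zer zer

    Strategy : (M → M) → Set
    Strategy 𝒮 = (o : M) → IsO o → IsO (𝒮 o) × (𝒮 o ⪯ o)

    PlayFollowing : (M → M) → (ℕ → M) → Set
    PlayFollowing 𝒮 o = IsEmptySeq (o 0) × ((k : ℕ) → IsO (o k))
      × ((k : ℕ) → o (suc k) ⪯ o k)
      × ((k : ℕ) → k % 3 ≡ 0 → o (suc k) ≡ 𝒮 (o k))

    PlayRel : (ℕ → M) → M → M → Set
    PlayRel o a b = ∃ λ k → a ◁[ o k ] b

    StrictLinearNoLeast : (M → M → Set) → Set
    StrictLinearNoLeast R =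
        ((a b : M) → R a b → (a < n) × (b < n))
      × ((a : M) → ¬ R a a)
      × ((a b c : M) → R a b → R b c → R a c)
      × ((a b : M) → a < n → b < n → R a b ⊎ (a ≡ b) ⊎ R b a)
      × ((a : M) → a < n → ∃ λ b → R b a)

    Winning : (M → M) → Set
    Winning 𝒮 = (o : ℕ → M) → PlayFollowing 𝒮 o → StrictLinearNoLeast (PlayRel o)

{-# OPTIONS --safe #-}
-- P_MIN fixes an enumeration e₀, e₁, … of the countable model 𝕄. On a condition o it
-- prepends to o the first eⱼ that lies in [0,n) but not in o, and in front of it some other
-- element of [0,n) not in o. Each condition orders its entries strictly and linearly and
-- extensions only add pairs, so the union ◁ is a strict linear order. By stage 3(j+1) every
-- eᵢ < n with i ≤ j is in the field of ◁, and everything in the field gets a predecessor at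
-- P_MIN's next move. Unused elements of [0,n) exist because a condition has at most |n|^e
-- entries for a standard e, far fewer than the nonstandard n. All the arithmetic of codes
-- (pairing, blocks of bits, powers of two, bit length) consists of first-order sentences
-- proved in ℕ and transferred to 𝕄 ⊨ Th(ℕ).
module Submission where

open import Data.Nat as ℕ using (ℕ; zero; suc)
open import Data.Product using (Σ; ∃; ∃₂; _×_; _,_; proj₁; proj₂; uncurry)
open import Data.Sum using (_⊎_; inj₁; inj₂; [_,_]′)
open import Data.Empty using (⊥-elim)
open import Relation.Binary.PropositionalEquality
open import Relation.Nullary using (¬_; yes; no)
open import Defs renaming
  ( _`=_ to infix 4 _`=_ ; _`≤_ to infix 4 _`≤_ ; _`+_ to infixl 6 _`+_ ; _`*_ to infixl 7 _`*_
  ; _`∧_ to infixr 3 _`∧_ ; _`∨_ to infixr 2 _`∨_ ; _`⇒_ to infixr 1 _`⇒_ )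

-- `IsSeq o l c` is `Pair l c o × Fits l c`, and `IsO o` unfolds to `Admissible l c` for
-- o = ⟨l , c⟩ together with a bound l ≼ |N|^e.
module Sequences (𝔄 : Structure) (N : Structure.Carrier 𝔄) where
  open Structure 𝔄
  open InModel 𝔄 renaming (_<_ to _<ₘ_)
  open WithN N

  Fits : M → M → Set
  Fits l c = ∃ λ p → Exp2 (W ⊗ l) p × (c <ₘ p)

  Mem : M → M → M → Set
  Mem l c v = ∃ λ i → (i <ₘ l) × Block c i v

  Distinct : M → M → Set
  Distinct l c = (i j v : M) → i <ₘ l → j <ₘ l → Block c i v → Block c j v → i ≡ j

  Bounded : M → M → Set
  Bounded l c = (i v : M) → i <ₘ l → Block c i v → v <ₘ N

  Admissible : M → M → Set
  Admissible l c = Fits l c × Distinct l c × Bounded l c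

  IsCons : M → M → M → M → Set
  IsCons l c x c′ = Admissible (l ⊕ one) c′ × Block c′ zer x
                  × ((i v : M) → i <ₘ l → Block c i v → Block c′ (i ⊕ one) v)

module StandardModel where

  open import Data.Nat
  open import Data.Nat.Properties
  open import Data.Nat.DivMod
  open import Data.Nat.Divisibility using (n∣m*n)
  open import Data.Nat.Logarithm using (⌈log₂⌉-mono-≤; ⌈log₂2^n⌉≡n)
  open import Data.Nat.Logarithm.Core using (⌈log2⌉)
  open import Data.Nat.Induction using (<-wellFounded)
  open import Data.Nat.Tactic.RingSolver using (solve-∀)
  open import Data.Fin using (Fin; toℕ; fromℕ<)
  open import Data.Fin.Properties using (pigeonhole; toℕ<n; toℕ-fromℕ<)
  open import Induction.WellFounded using (Acc; acc)
  open import Relation.Binary.Definitions using (tri<; tri≈; tri>)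
  open import Relation.Nullary using (¬?; contradiction)
  open import Relation.Nullary.Decidable using (decidable-stable)
  open import Relation.Unary using (Decidable)
  open InModel ℕ-str using (Exp2; Pair) renaming (_∣_ to _∣ₘ_; _<_ to infix 4 _<ₘ_)

  ⌈log2⌉≤⇒≤2^ : ∀ m k (rec : Acc _<_ m) → ⌈log2⌉ m rec ≤ k → m ≤ 2 ^ k
  ⌈log2⌉≤⇒≤2^ zero          k       _   _ = z≤n
  ⌈log2⌉≤⇒≤2^ (suc zero)    k       _   _ = m^n>0 2 k
  ⌈log2⌉≤⇒≤2^ (suc (suc m)) (suc k) (acc rs) (s≤s ≤k) = begin
    2 + m                         ≤⟨ +-monoʳ-≤ 2 m≤h+h ⟩
    2 + (⌈ m /2⌉ + ⌈ m /2⌉)       ≡⟨ cong suc (sym (+-suc _ _)) ⟩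
    suc ⌈ m /2⌉ + suc ⌈ m /2⌉     ≤⟨ +-mono-≤ IH (≤-trans IH (m≤m+n _ 0)) ⟩
    2 ^ suc k                     ∎
    where
    open ≤-Reasoning
    IH = ⌈log2⌉≤⇒≤2^ (suc ⌈ m /2⌉) k _ ≤k
    m≤h+h : m ≤ ⌈ m /2⌉ + ⌈ m /2⌉
    m≤h+h = subst (_≤ ⌈ m /2⌉ + ⌈ m /2⌉) (⌊n/2⌋+⌈n/2⌉≡n m) (+-monoˡ-≤ ⌈ m /2⌉ (⌊n/2⌋≤⌈n/2⌉ m))

  x<2^∣x∣ : ∀ x → x < 2 ^ ∣ x ∣ℕ
  x<2^∣x∣ x = ⌈log2⌉≤⇒≤2^ (suc x) ∣ x ∣ℕ (<-wellFounded (suc x)) ≤-refl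

  <2^⇒∣∣≤ : ∀ {x k} → x < 2 ^ k → ∣ x ∣ℕ ≤ k
  <2^⇒∣∣≤ {k = k} x<2^k = ≤-trans (⌈log₂⌉-mono-≤ x<2^k) (≤-reflexive (⌈log₂2^n⌉≡n k))

  ∣∣-mono-≤ : ∀ {x y} → x ≤ y → ∣ x ∣ℕ ≤ ∣ y ∣ℕ
  ∣∣-mono-≤ x≤y = ⌈log₂⌉-mono-≤ (s≤s x≤y)

  ∣x∣≡1+k⇒2^k≤x : ∀ {x k} → ∣ x ∣ℕ ≡ suc k → 2 ^ k ≤ x
  ∣x∣≡1+k⇒2^k≤x {x} {k} ∣x∣≡1+k = ≮⇒≥ λ x<2^k → 1+n≰n (subst (_≤ k) ∣x∣≡1+k (<2^⇒∣∣≤ x<2^k))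

  2^k≤x<2^[1+k]⇒∣x∣≡1+k : ∀ {x k} → 2 ^ k ≤ x → x < 2 ^ suc k → ∣ x ∣ℕ ≡ suc k
  2^k≤x<2^[1+k]⇒∣x∣≡1+k {x} {k} 2^k≤x x<2^[1+k] = ≤-antisym (<2^⇒∣∣≤ x<2^[1+k]) (≮⇒≥ ∣x∣≤k)
    where
    ∣x∣≤k : ∣ x ∣ℕ ≮ suc k
    ∣x∣≤k (s≤s ∣x∣≤k) = <⇒≱ (<-≤-trans (x<2^∣x∣ x) (^-monoʳ-≤ 2 ∣x∣≤k)) 2^k≤x

  ∣2^k∣≡1+k : ∀ k → ∣ 2 ^ k ∣ℕ ≡ suc k
  ∣2^k∣≡1+k k = 2^k≤x<2^[1+k]⇒∣x∣≡1+k ≤-refl (^-monoʳ-< 2 (s≤s (s≤s z≤n)) (n<1+n k))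

  even⊎odd : ∀ n → ∃ λ h → n ≡ 2 * h ⊎ n ≡ suc (2 * h)
  even⊎odd zero = 0 , inj₁ refl
  even⊎odd (suc n) with even⊎odd n
  ... | h , inj₁ refl = h , inj₂ refl
  ... | h , inj₂ refl = suc h , inj₁ (cong suc (sym (+-suc h (h + 0))))

  divisor-of-2^ : ∀ k {d f} → d * f ≡ 2 ^ k → d ≡ 1 ⊎ ∃ λ e → d ≡ e + e
  divisor-of-2^ zero    {d} {f} d*f≡1 = inj₁ (m*n≡1⇒m≡1 d f d*f≡1)
  divisor-of-2^ (suc k) {d} {f} d*f≡2^[1+k] with even⊎odd d | even⊎odd f
  ... | a , inj₁ refl | _ = inj₂ (a , cong (a +_) (+-identityʳ a))
  ... | a , inj₂ refl | b , inj₂ refl =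
    ⊥-elim (even≢odd (2 ^ k) (a + b + 2 * a * b) (trans (sym d*f≡2^[1+k]) (odd*odd a b)))
    where
    odd*odd : ∀ a b → suc (2 * a) * suc (2 * b) ≡ suc (2 * (a + b + 2 * a * b))
    odd*odd = solve-∀
  ... | a , inj₂ refl | b , inj₁ refl =
    divisor-of-2^ k {f = b} (*-cancelˡ-≡ _ _ 2 (trans (d*[2*b] (suc (2 * a)) b) d*f≡2^[1+k]))
    where
    d*[2*b] : ∀ d b → 2 * (d * b) ≡ d * (2 * b)
    d*[2*b] = solve-∀

  Exp2-2^ : ∀ k → Exp2 k (2 ^ k)
  Exp2-2^ k = (λ d (_ , d*f≡2^k) → divisor-of-2^ k d*f≡2^k) , trans (∣2^k∣≡1+k k) (+-comm 1 k)

  Exp2⇒≡2^ : ∀ k {p} → Exp2 k p → p ≡ 2 ^ k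
  Exp2⇒≡2^ zero {p} (_ , ∣p∣≡1) =
    ≤-antisym (≤-pred (subst (λ b → p < 2 ^ b) ∣p∣≡1 (x<2^∣x∣ p))) (∣x∣≡1+k⇒2^k≤x ∣p∣≡1)
  -- p divides itself, hence is even (p ≠ 1 by its bit length), and half of p satisfies Exp2 k.
  Exp2⇒≡2^ (suc k) {p} (divisors , ∣p∣≡2+k) with divisors p (1 , *-identityʳ p)
  ... | inj₁ refl = ⊥-elim (1+n≢0 (m+n≡0⇒n≡0 k (suc-injective (trans (sym ∣p∣≡2+k) (∣2^k∣≡1+k 0)))))
  ... | inj₂ (e , refl) = begin
    e + e         ≡⟨ cong (λ x → x + x) (Exp2⇒≡2^ k (divisors-e , ∣e∣≡k+1)) ⟩
    2 ^ k + 2 ^ k ≡⟨ cong (2 ^ k +_) (sym (+-identityʳ (2 ^ k))) ⟩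
    2 ^ suc k     ∎
    where
    open ≡-Reasoning
    e+e≡2*e : e + e ≡ 2 * e
    e+e≡2*e = cong (e +_) (sym (+-identityʳ e))
    divisors-e : ∀ d → d ∣ₘ e → d ≡ 1 ⊎ ∃ λ e → d ≡ e + e
    divisors-e d (g , d*g≡e) = divisors d (g + g , trans (*-distribˡ-+ d g g) (cong₂ _+_ d*g≡e d*g≡e))
    ∣2e∣≡2+k : ∣ 2 * e ∣ℕ ≡ suc (suc k)
    ∣2e∣≡2+k = trans (cong ∣_∣ℕ (sym e+e≡2*e)) (trans ∣p∣≡2+k (cong suc (+-comm k 1)))
    ∣e∣≡k+1 : ∣ e ∣ℕ ≡ k + 1
    ∣e∣≡k+1 = trans (2^k≤x<2^[1+k]⇒∣x∣≡1+k
        (*-cancelˡ-≤ 2 (∣x∣≡1+k⇒2^k≤x ∣2e∣≡2+k))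
        (*-cancelˡ-< 2 e _ (subst (λ b → 2 * e < 2 ^ b) ∣2e∣≡2+k (x<2^∣x∣ (2 * e)))))
      (+-comm 1 k)

  triangle : ℕ → ℕ
  triangle zero    = 0
  triangle (suc s) = triangle s + suc s

  triangle-mono-≤ : ∀ {m n} → m ≤ n → triangle m ≤ triangle n
  triangle-mono-≤ {n = zero}  z≤n = z≤n
  triangle-mono-≤ {n = suc n} z≤n = ≤-trans (triangle-mono-≤ {n = n} z≤n) (m≤m+n _ _)
  triangle-mono-≤ (s≤s m≤n) = +-mono-≤ (triangle-mono-≤ m≤n) (s≤s m≤n)

  triangle+triangle : ∀ s → triangle s + triangle s ≡ s * (s + 1)
  triangle+triangle zero    = refl
  triangle+triangle (suc s) = begin
    (t + suc s) + (t + suc s) ≡⟨ regroup t s ⟩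
    (t + t) + 2 * suc s       ≡⟨ cong (_+ 2 * suc s) (triangle+triangle s) ⟩
    s * (s + 1) + 2 * suc s   ≡⟨ expand s ⟩
    suc s * (suc s + 1)       ∎
    where
    open ≡-Reasoning
    t = triangle s
    regroup : ∀ t s → (t + suc s) + (t + suc s) ≡ (t + t) + 2 * suc s
    regroup = solve-∀
    expand : ∀ s → s * (s + 1) + 2 * suc s ≡ suc s * (suc s + 1)
    expand = solve-∀

  pair : ℕ → ℕ → ℕ
  pair l c = triangle (l + c) + c

  Pair-pair : ∀ l c → Pair l c (pair l c)
  Pair-pair l c = begin
    (t + c) + (t + c) ≡⟨ regroup t c ⟩
    (t + t) + (c + c) ≡⟨ cong (_+ (c + c)) (triangle+triangle (l + c)) ⟩
    (l + c) * ((l + c) + 1) + (c + c) ∎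
    where
    open ≡-Reasoning
    t = triangle (l + c)
    regroup : ∀ t c → (t + c) + (t + c) ≡ (t + t) + (c + c)
    regroup = solve-∀

  m+m≡n+n⇒m≡n : ∀ {m n} → m + m ≡ n + n → m ≡ n
  m+m≡n+n⇒m≡n {m} {n} eq =
    *-cancelˡ-≡ m n 2 (trans (cong (m +_) (+-identityʳ m)) (trans eq (cong (n +_) (sym (+-identityʳ n)))))

  Pair⇒≡pair : ∀ l c {o} → Pair l c o → o ≡ pair l c
  Pair⇒≡pair l c P = m+m≡n+n⇒m≡n (trans P (sym (Pair-pair l c)))

  pair<triangle[1+l+c] : ∀ l c → pair l c < triangle (suc (l + c))
  pair<triangle[1+l+c] l c = +-monoʳ-< (triangle (l + c)) (s≤s (m≤n+m c l))

  pair-injective : ∀ {l c l′ c′} → pair l c ≡ pair l′ c′ → l ≡ l′ × c ≡ c′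
  pair-injective {l} {c} {l′} {c′} eq = l≡l′ , c≡c′
    where
    sum-below : ∀ l c l′ c′ → pair l c ≡ pair l′ c′ → l + c ≤ l′ + c′
    sum-below l c l′ c′ eq = ≮⇒≥ λ l′+c′<l+c → <⇒≱
      (subst (_< triangle (suc (l′ + c′))) (sym eq) (pair<triangle[1+l+c] l′ c′))
      (≤-trans (triangle-mono-≤ l′+c′<l+c) (m≤m+n _ c))
    s≡s′ : l + c ≡ l′ + c′
    s≡s′ = ≤-antisym (sum-below l c l′ c′ eq) (sum-below l′ c′ l c (sym eq))
    c≡c′ : c ≡ c′
    c≡c′ = +-cancelˡ-≡ (triangle (l + c)) c c′ (trans eq (cong (λ s → triangle s + c′) (sym s≡s′)))
    l≡l′ : l ≡ l′
    l≡l′ = +-cancelʳ-≡ c l l′ (trans s≡s′ (cong (l′ +_) (sym c≡c′)))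

  pair-surjective : ∀ o → ∃₂ λ l c → pair l c ≡ o
  pair-surjective zero = 0 , 0 , refl
  pair-surjective (suc o) with pair-surjective o
  ... | suc l , c , refl = l , suc c , (begin
    triangle (l + suc c) + suc c ≡⟨ cong (λ s → triangle s + suc c) (+-suc l c) ⟩
    triangle (suc l + c) + suc c ≡⟨ +-suc _ c ⟩
    suc (triangle (suc l + c) + c) ∎)
    where open ≡-Reasoning
  ... | zero , c , refl = suc c , 0 , (begin
    triangle (suc c + 0) + 0     ≡⟨ +-identityʳ _ ⟩
    triangle (suc c + 0)         ≡⟨ cong triangle (+-identityʳ (suc c)) ⟩
    triangle c + suc c           ≡⟨ +-suc (triangle c) c ⟩
    suc (triangle c + c)         ∎)
    where open ≡-Reasoning

  [s*p+t]/p≡s : ∀ s {p t} .{{_ : NonZero p}} → t < p → (s * p + t) / p ≡ s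
  [s*p+t]/p≡s s {p} {t} t<p = begin
    (s * p + t) / p   ≡⟨ +-distrib-/-∣ˡ t (n∣m*n s) ⟩
    s * p / p + t / p ≡⟨ cong₂ _+_ (m*n/n≡m s p) (m<n⇒m/n≡0 t<p) ⟩
    s + 0             ≡⟨ +-identityʳ s ⟩
    s                 ∎
    where open ≡-Reasoning

  [s*p+t]%p≡t : ∀ s {p t} .{{_ : NonZero p}} → t < p → (s * p + t) % p ≡ t
  [s*p+t]%p≡t s {p} t<p = trans (%-remove-+ˡ _ (n∣m*n s)) (m<n⇒m%n≡m t<p)

  module Digits (b : ℕ) .{{_ : NonZero b}} where

    digit : ℕ → ℕ → ℕ
    digit c zero    = c % b
    digit c (suc i) = digit (c / b) i

    _∷ᵈ_ : ℕ → ℕ → ℕ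
    x ∷ᵈ c = c * b + x

    digit-∷ᵈ-zero : ∀ {x} c → x < b → digit (x ∷ᵈ c) 0 ≡ x
    digit-∷ᵈ-zero c = [s*p+t]%p≡t c

    digit-∷ᵈ-suc : ∀ {x} c i → x < b → digit (x ∷ᵈ c) (suc i) ≡ digit c i
    digit-∷ᵈ-suc c i x<b = cong (λ c → digit c i) ([s*p+t]/p≡s c x<b)

    ∷ᵈ-< : ∀ {x c} l → x < b → c < b ^ l → x ∷ᵈ c < b ^ suc l
    ∷ᵈ-< {x} {c} l x<b c<b^l = begin-strict
      c * b + x ≡⟨ +-comm (c * b) x ⟩
      x + c * b <⟨ +-monoˡ-< (c * b) x<b ⟩
      suc c * b ≤⟨ *-monoˡ-≤ b c<b^l ⟩
      b ^ l * b ≡⟨ *-comm (b ^ l) b ⟩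
      b ^ suc l ∎
      where open ≤-Reasoning

    digit-[s*b^i+t] : ∀ s i {t} → t < b ^ i → digit (s * b ^ i + t) i ≡ s % b
    digit-[s*b^i+t] s zero {t} t<1 rewrite n<1⇒n≡0 t<1 =
      cong (_% b) (trans (+-identityʳ (s * 1)) (*-identityʳ s))
    digit-[s*b^i+t] s (suc i) {t} t<b^[1+i] = begin
      digit ((s * (b * b ^ i) + t) / b) i ≡⟨ cong (λ c → digit c i) quotient ⟩
      digit (s * b ^ i + t / b) i         ≡⟨ digit-[s*b^i+t] s i t/b<b^i ⟩
      s % b                               ∎
      where
      open ≡-Reasoning
      t/b<b^i : t / b < b ^ i
      t/b<b^i = m<n*o⇒m/o<n (subst (t <_) (*-comm b (b ^ i)) t<b^[1+i])
      *-rearrange : ∀ s b c → s * (b * c) ≡ s * c * b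
      *-rearrange = solve-∀
      quotient : (s * (b * b ^ i) + t) / b ≡ s * b ^ i + t / b
      quotient = begin
        (s * (b * b ^ i) + t) / b       ≡⟨ cong (λ x → (x + t) / b) (*-rearrange s b (b ^ i)) ⟩
        (s * b ^ i * b + t) / b         ≡⟨ +-distrib-/-∣ˡ t (n∣m*n (s * b ^ i)) ⟩
        s * b ^ i * b / b + t / b       ≡⟨ cong (_+ t / b) (m*n/n≡m (s * b ^ i) b) ⟩
        s * b ^ i + t / b               ∎

  pigeonhole-ℕ : ∀ (g : ℕ → ℕ) l → ¬ (∀ v → v ≤ l → ∃ λ i → i < l × g i ≡ v)
  pigeonhole-ℕ g l hit = let (u , v , u<v , same) = pigeonhole (n<1+n l) index in
    <-irrefl (trans (sym (value u)) (trans (cong (λ i → g (toℕ i)) same) (value v))) u<v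
    where
    index : Fin (suc l) → Fin l
    index v = fromℕ< (proj₁ (proj₂ (hit (toℕ v) (≤-pred (toℕ<n v)))))
    value : ∀ v → g (toℕ (index v)) ≡ toℕ v
    value v = trans (cong g (toℕ-fromℕ< _)) (proj₂ (proj₂ (hit (toℕ v) _)))

  missing-value : ∀ (g : ℕ → ℕ) l → ∃ λ v → v ≤ l × (∀ {i} → i < l → g i ≢ v)
  missing-value g l with anyUpTo? (λ v → ¬? (anyUpTo? (λ i → g i ≟ v) l)) (suc l)
  ... | yes (v , v<1+l , ¬hit) = v , ≤-pred v<1+l , λ i<l gi≡v → ¬hit (_ , i<l , gi≡v)
  ... | no none = ⊥-elim (pigeonhole-ℕ g l λ v v≤l →
    decidable-stable (anyUpTo? (λ i → g i ≟ v) l) (λ ¬hit → none (v , s≤s v≤l , ¬hit)))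

  linear≤exponential-threshold : ∀ e → suc (4 + 2 * e) * e + 3 ≤ 2 ^ (4 + 2 * e)
  linear≤exponential-threshold zero    = m≤m+n 3 13
  linear≤exponential-threshold (suc e) = begin
    suc (4 + 2 * suc e) * suc e + 3 ≤⟨ m≤m+n _ (6 * e * e + 11 * e + 2) ⟩
    suc (4 + 2 * suc e) * suc e + 3 + (6 * e * e + 11 * e + 2) ≡⟨ slack e ⟩
    4 * (suc (4 + 2 * e) * e + 3)   ≤⟨ *-monoʳ-≤ 4 (linear≤exponential-threshold e) ⟩
    4 * 2 ^ (4 + 2 * e)             ≡⟨ ^-distribˡ-+-* 2 2 (4 + 2 * e) ⟨
    2 ^ (2 + (4 + 2 * e))           ≡⟨ cong (2 ^_) (exponent e) ⟩
    2 ^ (4 + 2 * suc e)             ∎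
    where
    open ≤-Reasoning
    slack : ∀ e → suc (4 + 2 * suc e) * suc e + 3 + (6 * e * e + 11 * e + 2) ≡ 4 * (suc (4 + 2 * e) * e + 3)
    slack = solve-∀
    exponent : ∀ e → 2 + (4 + 2 * e) ≡ 4 + 2 * suc e
    exponent = solve-∀

  linear≤exponential : ∀ e m → 4 + 2 * e ≤ m → suc m * e + 3 ≤ 2 ^ m
  linear≤exponential e zero ()
  linear≤exponential e (suc m) m₀≤1+m with m≤n⇒m<n∨m≡n m₀≤1+m
  ... | inj₂ m₀≡1+m = subst (λ k → suc k * e + 3 ≤ 2 ^ k) m₀≡1+m (linear≤exponential-threshold e)
  ... | inj₁ m₀<1+m = begin
    suc (suc m) * e + 3     ≡⟨ split m e ⟩
    (suc m * e + 3) + e     ≤⟨ +-mono-≤ IH (≤-trans (≤-trans (m≤m+n e (m * e)) (m≤m+n _ 3)) IH) ⟩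
    2 ^ m + 2 ^ m           ≡⟨ cong (2 ^ m +_) (+-identityʳ (2 ^ m)) ⟨
    2 ^ suc m               ∎
    where
    open ≤-Reasoning
    IH = linear≤exponential e m (≤-pred m₀<1+m)
    split : ∀ m e → suc (suc m) * e + 3 ≡ (suc m * e + 3) + e
    split = solve-∀

  m+2≤m*n : ∀ {m n} → 1 ≤ m → 3 ≤ n → m + 2 ≤ m * n
  m+2≤m*n {m} {n} 1≤m 3≤n = begin
    m + 2           ≤⟨ +-monoʳ-≤ m (+-mono-≤ 1≤m (+-monoˡ-≤ 0 1≤m)) ⟩
    m + (m + (m + 0)) ≡⟨ *-comm 3 m ⟩
    m * 3           ≤⟨ *-monoʳ-≤ m 3≤n ⟩
    m * n           ∎
    where open ≤-Reasoning

  suc≤⇒≡suc : ∀ {k n} → suc k ≤ n → ∃ λ m → n ≡ suc m × k ≤ m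
  suc≤⇒≡suc (s≤s k≤m) = _ , refl , k≤m

  K : ℕ → ℕ
  K e = 2 ^ (2 ^ (4 + 2 * e))

  -- With L = |x| and M = |L|: L^e ≤ 2^(M·e), and M·e + 3 ≤ 2^(M-1) ≤ L by linear≤exponential,
  -- so L^e + 2 ≤ 2^(L-1) ≤ x.
  growth : ∀ e {x l} → K e ≤ x → l ≤ ∣ x ∣ℕ ^ e
         → (l + 1) + 1 ≤ ∣ x ∣ℕ ^ e * ∣ x ∣ℕ × (l + 1) + 1 ≤ x
  growth e {x} {l} K≤x l≤L^e = ≤-trans l+2≤L^e+2 (m+2≤m*n 1≤L^e 3≤L) , ≤-trans l+2≤L^e+2 L^e+2≤x
    where
    L = ∣ x ∣ℕ
    k = 4 + 2 * e
    1+2^k≤L : suc (2 ^ k) ≤ L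
    1+2^k≤L = subst (_≤ L) (∣2^k∣≡1+k (2 ^ k)) (∣∣-mono-≤ K≤x)
    3≤L : 3 ≤ L
    3≤L = ≤-trans (s≤s (^-monoʳ-≤ 2 {1} {k} (s≤s z≤n))) 1+2^k≤L
    1≤L^e : 1 ≤ L ^ e
    1≤L^e = subst (_≤ L ^ e) (^-zeroˡ e) (^-monoˡ-≤ e (≤-trans (s≤s z≤n) 3≤L))
    l+2≤L^e+2 : (l + 1) + 1 ≤ L ^ e + 2
    l+2≤L^e+2 = subst (_≤ L ^ e + 2) (sym (+-assoc l 1 1)) (+-monoˡ-≤ 2 l≤L^e)
    L^e+2≤x : L ^ e + 2 ≤ x
    L^e+2≤x with suc≤⇒≡suc (subst (_≤ ∣ L ∣ℕ) (∣2^k∣≡1+k k) (∣∣-mono-≤ (≤-trans (n≤1+n _) 1+2^k≤L)))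
                  | suc≤⇒≡suc (≤-trans (s≤s z≤n) 3≤L)
    ... | m , ∣L∣≡1+m , k≤m | L′ , L≡1+L′ , _ = begin
      L ^ e + 2                 ≤⟨ +-monoˡ-≤ 2 L^e≤2^[M*e] ⟩
      2 ^ (M * e) + 2           ≤⟨ m+2≤m*n (m^n>0 2 (M * e)) (n≤1+n 3) ⟩
      2 ^ (M * e) * 4           ≡⟨ ^-distribˡ-+-* 2 (M * e) 2 ⟨
      2 ^ (M * e + 2)           ≤⟨ ^-monoʳ-≤ 2 M*e+2≤L′ ⟩
      2 ^ L′                    ≤⟨ ∣x∣≡1+k⇒2^k≤x L≡1+L′ ⟩
      x                         ∎
      where
      open ≤-Reasoning
      M = suc m
      L^e≤2^[M*e] : L ^ e ≤ 2 ^ (M * e)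
      L^e≤2^[M*e] = subst (λ M → L ^ e ≤ 2 ^ (M * e)) ∣L∣≡1+m
        (≤-trans (^-monoˡ-≤ e (<⇒≤ (x<2^∣x∣ L))) (≤-reflexive (^-*-assoc 2 ∣ L ∣ℕ e)))
      M*e+2≤L′ : M * e + 2 ≤ L′
      M*e+2≤L′ = ≤-pred (subst (_≤ suc L′) (+-suc (M * e) 2) (subst (M * e + 3 ≤_) L≡1+L′
        (≤-trans (linear≤exponential e m k≤m) (∣x∣≡1+k⇒2^k≤x ∣L∣≡1+m))))

  module _ {P : ℕ → Set} (P? : Decidable P) where

    Least : ℕ → Set
    Least j = P j × (∀ {k} → k < j → ¬ P k)

    least : ∀ {m} → P m → ∃ Least
    least {m} Pm = go m Pm (<-wellFounded m)
      where
      go : ∀ m → P m → Acc _<_ m → ∃ Least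
      go m Pm (acc rs) with anyUpTo? P? m
      ... | yes (k , k<m , Pk) = go k Pk (rs k<m)
      ... | no none            = m , Pm , λ k<m Pk → none (_ , k<m , Pk)

    least-below : ℕ → ℕ
    least-below b with anyUpTo? P? b
    ... | yes (_ , _ , Pm) = proj₁ (least Pm)
    ... | no _             = b

    least-below-least : ∀ {m b} → P m → m < b → Least (least-below b)
    least-below-least {m} {b} Pm m<b with anyUpTo? P? b
    ... | yes (_ , _ , Pm′) = proj₂ (least Pm′)
    ... | no none           = ⊥-elim (none (m , m<b , Pm))

    Least-unique : ∀ {j k} → Least j → Least k → j ≡ k
    Least-unique {j} {k} (Pj , j-min) (Pk , k-min) with <-cmp j k
    ... | tri< j<k _ _ = contradiction Pj (k-min j<k)
    ... | tri≈ _ j≡k _ = j≡k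
    ... | tri> _ _ k<j = contradiction Pk (j-min k<j)

  <⇒<ₘ : ∀ {m n} → m < n → m <ₘ n
  <⇒<ₘ m<n = <⇒≤ m<n , <⇒≢ m<n

  <ₘ⇒< : ∀ {m n} → m <ₘ n → m < n
  <ₘ⇒< = uncurry ≤∧≢⇒<

  module NatSequences (N : ℕ) where
    open InModel.WithN ℕ-str N using (W; Block)
    open Sequences ℕ-str N

    Q : ℕ
    Q = 2 ^ W

    instance
      Q≢0 : NonZero Q
      Q≢0 = m^n≢0 2 W

    open Digits Q public

    N<Q : N < Q
    N<Q = x<2^∣x∣ N

    Exp2-Q^ : ∀ i → Exp2 (W * i) (Q ^ i)
    Exp2-Q^ i = subst (Exp2 (W * i)) (sym (^-*-assoc 2 W i)) (Exp2-2^ (W * i))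

    Exp2⇒≡Q^ : ∀ i {p} → Exp2 (W * i) p → p ≡ Q ^ i
    Exp2⇒≡Q^ i E = trans (Exp2⇒≡2^ (W * i) E) (sym (^-*-assoc 2 W i))

    Block⇒≡digit : ∀ {c i v} → Block c i v → v ≡ digit c i
    Block⇒≡digit {i = i} (p , q , s , t , u , Ep , Eq , refl , t<p , refl , v<q)
      with refl ← Exp2⇒≡Q^ i Ep | refl ← Exp2⇒≡2^ W Eq =
      trans (sym ([s*p+t]%p≡t u (<ₘ⇒< v<q))) (sym (digit-[s*b^i+t] _ i (<ₘ⇒< t<p)))

    Block-digit : ∀ c i → Block c i (digit c i)
    Block-digit c i = subst (Block c i) (sym digit≡s%Q)
      (Q ^ i , Q , s , c % Q ^ i , s / Q , Exp2-Q^ i , Exp2-2^ W , c≡s*Q^i+t , <⇒<ₘ (m%n<n c (Q ^ i))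
      , trans (m≡m%n+[m/n]*n s Q) (+-comm (s % Q) _) , <⇒<ₘ (m%n<n s Q))
      where
      instance
        Q^i≢0 : NonZero (Q ^ i)
        Q^i≢0 = m^n≢0 Q i
      s = c / Q ^ i
      c≡s*Q^i+t : c ≡ s * Q ^ i + c % Q ^ i
      c≡s*Q^i+t = trans (m≡m%n+[m/n]*n c (Q ^ i)) (+-comm (c % Q ^ i) _)
      digit≡s%Q : digit c i ≡ s % Q
      digit≡s%Q = trans (cong (λ c → digit c i) c≡s*Q^i+t) (digit-[s*b^i+t] s i (m%n<n c (Q ^ i)))

    Block-functional : ∀ {c i v v′} → Block c i v → Block c i v′ → v ≡ v′
    Block-functional B B′ = trans (Block⇒≡digit B) (sym (Block⇒≡digit B′))

    ≡digit⇒Block : ∀ {c i v} → v ≡ digit c i → Block c i v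
    ≡digit⇒Block {c} {i} v≡digit = subst (Block c i) (sym v≡digit) (Block-digit c i)

    Fits⇒<Q^ : ∀ {l c} → Fits l c → c < Q ^ l
    Fits⇒<Q^ {l} (p , E , c<p) = subst (_ <_) (Exp2⇒≡Q^ l E) (<ₘ⇒< c<p)

    <Q^⇒Fits : ∀ {l c} → c < Q ^ l → Fits l c
    <Q^⇒Fits {l} c<Q^l = Q ^ l , Exp2-Q^ l , <⇒<ₘ c<Q^l

    Mem? : ∀ l c v → Mem l c v ⊎ ¬ Mem l c v
    Mem? l c v with anyUpTo? (λ i → v ≟ digit c i) l
    ... | yes (i , i<l , v≡digit) = inj₁ (i , <⇒<ₘ i<l , ≡digit⇒Block v≡digit)
    ... | no ¬mem = inj₂ λ (i , i<l , B) → ¬mem (i , <ₘ⇒< i<l , Block⇒≡digit B)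

    fresh : ∀ l c → ∃ λ v → l + 1 ≤ N → v <ₘ N × ¬ Mem l c v
    fresh l c with missing-value (digit c) l
    ... | v , v≤l , missing = v , λ l+1≤N →
      <⇒<ₘ (≤-<-trans v≤l (subst (_≤ N) (+-comm l 1) l+1≤N)) ,
      λ (i , i<l , B) → missing (<ₘ⇒< i<l) (sym (Block⇒≡digit B))

    Block-∷ᵈ-zero : ∀ {x} c → x < Q → Block (x ∷ᵈ c) 0 x
    Block-∷ᵈ-zero c x<Q = ≡digit⇒Block (sym (digit-∷ᵈ-zero c x<Q))

    Block-∷ᵈ-suc : ∀ {x c i v} → x < Q → Block c i v → Block (x ∷ᵈ c) (suc i) v
    Block-∷ᵈ-suc {c = c} {i} x<Q B = ≡digit⇒Block (trans (Block⇒≡digit B) (sym (digit-∷ᵈ-suc c i x<Q)))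

    Block-∷ᵈ⁻ : ∀ {x} c {j v} → x < Q → Block (x ∷ᵈ c) j v
             → (j ≡ 0 × v ≡ x) ⊎ ∃ λ i → j ≡ suc i × Block c i v
    Block-∷ᵈ⁻ c {zero}  x<Q B = inj₁ (refl , Block-functional B (Block-∷ᵈ-zero c x<Q))
    Block-∷ᵈ⁻ c {suc i} x<Q B = inj₂ (i , refl , ≡digit⇒Block (trans (Block⇒≡digit B) (digit-∷ᵈ-suc c i x<Q)))

    ∷ᵈ-Admissible : ∀ {l c x} → Admissible l c → x <ₘ N → ¬ Mem l c x → Admissible (l + 1) (x ∷ᵈ c)
    ∷ᵈ-Admissible {l} {c} {x} (fits , distinct , bounded) x<N x∉c = fits′ , distinct′ , bounded′
      where
      x<Q = <-trans (<ₘ⇒< x<N) N<Q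
      pred< : ∀ {i} → suc i <ₘ l + 1 → i <ₘ l
      pred< {i} i+1<l+1 = <⇒<ₘ (s<s⁻¹ (subst (suc i <_) (+-comm l 1) (<ₘ⇒< i+1<l+1)))
      fits′ : Fits (l + 1) (x ∷ᵈ c)
      fits′ = <Q^⇒Fits (subst (λ k → x ∷ᵈ c < Q ^ k) (+-comm 1 l) (∷ᵈ-< l x<Q (Fits⇒<Q^ fits)))
      distinct′ : Distinct (l + 1) (x ∷ᵈ c)
      distinct′ i j v i<l+1 j<l+1 Bi Bj with Block-∷ᵈ⁻ c x<Q Bi | Block-∷ᵈ⁻ c x<Q Bj
      ... | inj₁ (refl , _)        | inj₁ (refl , _)        = refl
      ... | inj₁ (_ , refl)        | inj₂ (j′ , refl , Bj′) = ⊥-elim (x∉c (j′ , pred< j<l+1 , Bj′))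
      ... | inj₂ (i′ , refl , Bi′) | inj₁ (_ , refl)        = ⊥-elim (x∉c (i′ , pred< i<l+1 , Bi′))
      ... | inj₂ (i′ , refl , Bi′) | inj₂ (j′ , refl , Bj′) =
        cong suc (distinct i′ j′ v (pred< i<l+1) (pred< j<l+1) Bi′ Bj′)
      bounded′ : Bounded (l + 1) (x ∷ᵈ c)
      bounded′ j v j<l+1 Bj with Block-∷ᵈ⁻ c x<Q Bj
      ... | inj₁ (_ , refl)        = x<N
      ... | inj₂ (i , refl , Bi)   = bounded i v (pred< j<l+1) Bi

    ∷ᵈ-IsCons : ∀ {l c x} → Admissible l c → x <ₘ N → ¬ Mem l c x → IsCons l c x (x ∷ᵈ c)
    ∷ᵈ-IsCons {c = c} {x} adm x<N x∉c =
      ∷ᵈ-Admissible adm x<N x∉c , Block-∷ᵈ-zero c x<Q ,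
      λ i v _ B → subst (λ j → Block (x ∷ᵈ c) j v) (+-comm 1 i) (Block-∷ᵈ-suc x<Q B)
      where x<Q = <-trans (<ₘ⇒< x<N) N<Q

-- Each builder mirrors a predicate of Defs or Sequences, so that `Sat 𝔄 ρ` of it reduces to
-- that predicate by computation; this is how `transfer` returns statements about 𝕄 in the
-- vocabulary of Defs.
module Formulas where

  open StandardModel
  open InModel ℕ-str using () renaming (_<_ to infix 4 _<ₘ_)
  open import Relation.Binary.Definitions using (tri<; tri≈; tri>)
  import Data.Nat.Properties as ℕ

  wk : Term → Term
  wk (var i)    = var (suc i)
  wk `0         = `0
  wk `1         = `1
  wk (s `+ t)   = wk s `+ wk t
  wk (s `* t)   = wk s `* wk t
  wk (s `# t)   = wk s `# wk t
  wk (`len t)   = `len (wk t)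
  wk (`half t)  = `half (wk t)

  wk^ : ℕ → Term → Term
  wk^ zero    t = t
  wk^ (suc k) t = wk (wk^ k t)

  infix 4 _`<_
  _`<_ : Term → Term → Formula
  s `< t = s `≤ t `∧ `¬ (s `= t)

  Divᶠ : Term → Term → Formula
  Divᶠ d p = `∃ (wk d `* var 0 `= wk p)

  Exp2ᶠ : Term → Term → Formula
  Exp2ᶠ k p = `∀ (Divᶠ (var 0) (wk p) `⇒ var 0 `= `1 `∨ `∃ (var 1 `= var 0 `+ var 0))
            `∧ `len p `= k `+ `1

  Pairᶠ : Term → Term → Term → Formula
  Pairᶠ l c o = o `+ o `= (l `+ c) `* (l `+ c `+ `1) `+ (c `+ c)

  Blockᶠ : Term → Term → Term → Term → Formula
  Blockᶠ N c i v = `∃ (`∃ (`∃ (`∃ (`∃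
    (Exp2ᶠ (`len (wk^ 5 N) `* wk^ 5 i) (var 4) `∧ Exp2ᶠ (`len (wk^ 5 N)) (var 3)
    `∧ wk^ 5 c `= var 2 `* var 4 `+ var 1 `∧ var 1 `< var 4
    `∧ var 2 `= var 0 `* var 3 `+ wk^ 5 v `∧ wk^ 5 v `< var 3)))))

  Fitsᶠ : Term → Term → Term → Formula
  Fitsᶠ N l c = `∃ (Exp2ᶠ (`len (wk N) `* wk l) (var 0) `∧ wk c `< var 0)

  Memᶠ : Term → Term → Term → Term → Formula
  Memᶠ N l c v = `∃ (var 0 `< wk l `∧ Blockᶠ (wk N) (wk c) (var 0) (wk v))

  Distinctᶠ : Term → Term → Term → Formula
  Distinctᶠ N l c = `∀ (`∀ (`∀ (var 2 `< wk^ 3 l `⇒ var 1 `< wk^ 3 l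
    `⇒ Blockᶠ (wk^ 3 N) (wk^ 3 c) (var 2) (var 0) `⇒ Blockᶠ (wk^ 3 N) (wk^ 3 c) (var 1) (var 0)
    `⇒ var 2 `= var 1)))

  Boundedᶠ : Term → Term → Term → Formula
  Boundedᶠ N l c = `∀ (`∀
    (var 1 `< wk^ 2 l `⇒ Blockᶠ (wk^ 2 N) (wk^ 2 c) (var 1) (var 0) `⇒ var 0 `< wk^ 2 N))

  Admissibleᶠ : Term → Term → Term → Formula
  Admissibleᶠ N l c = Fitsᶠ N l c `∧ Distinctᶠ N l c `∧ Boundedᶠ N l c

  numᵗ : ℕ → Term
  numᵗ zero    = `0
  numᵗ (suc k) = numᵗ k `+ `1

  powᵗ : Term → ℕ → Term
  powᵗ t zero    = `1
  powᵗ t (suc e) = powᵗ t e `* t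

  eval-numᵗ : ∀ 𝔄 ρ k → evalT 𝔄 ρ (numᵗ k) ≡ InModel.numeral 𝔄 k
  eval-numᵗ 𝔄 ρ zero    = refl
  eval-numᵗ 𝔄 ρ (suc k) = cong (λ a → Structure._⊕_ 𝔄 a (Structure.one 𝔄)) (eval-numᵗ 𝔄 ρ k)

  eval-powᵗ : ∀ 𝔄 ρ t e → evalT 𝔄 ρ (powᵗ t e) ≡ InModel._^ˢ_ 𝔄 (evalT 𝔄 ρ t) e
  eval-powᵗ 𝔄 ρ t zero    = refl
  eval-powᵗ 𝔄 ρ t (suc e) = cong (λ a → Structure._⊗_ 𝔄 a (evalT 𝔄 ρ t)) (eval-powᵗ 𝔄 ρ t e)

  numeral-ℕ : ∀ k → InModel.numeral ℕ-str k ≡ k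
  numeral-ℕ zero    = refl
  numeral-ℕ (suc k) = trans (cong (ℕ._+ 1) (numeral-ℕ k)) (ℕ.+-comm k 1)

  ^ˢ-ℕ : ∀ a e → InModel._^ˢ_ ℕ-str a e ≡ a ℕ.^ e
  ^ˢ-ℕ a zero    = refl
  ^ˢ-ℕ a (suc e) = trans (cong (ℕ._* a) (^ˢ-ℕ a e)) (ℕ.*-comm (a ℕ.^ e) a)

  <-decᶠ : Formula
  <-decᶠ = `∀ (`∀ (var 1 `< var 0 `∨ `¬ (var 1 `< var 0)))

  ℕ⊨<-decᶠ : Valid ℕ-str <-decᶠ
  ℕ⊨<-decᶠ _ a b with a ℕ.<? b
  ... | yes a<b = inj₁ (<⇒<ₘ a<b)
  ... | no a≮b  = inj₂ λ a<b → a≮b (<ₘ⇒< a<b)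

  <-transᶠ : Formula
  <-transᶠ = `∀ (`∀ (`∀ (var 2 `< var 1 `⇒ var 1 `< var 0 `⇒ var 2 `< var 0)))

  ℕ⊨<-transᶠ : Valid ℕ-str <-transᶠ
  ℕ⊨<-transᶠ _ a b c a<b b<c = <⇒<ₘ (ℕ.<-trans (<ₘ⇒< a<b) (<ₘ⇒< b<c))

  <-trichotomyᶠ : Formula
  <-trichotomyᶠ = `∀ (`∀ (var 1 `< var 0 `∨ var 1 `= var 0 `∨ var 0 `< var 1))

  ℕ⊨<-trichotomyᶠ : Valid ℕ-str <-trichotomyᶠ
  ℕ⊨<-trichotomyᶠ _ a b with ℕ.<-cmp a b
  ... | tri< a<b _ _ = inj₁ (<⇒<ₘ a<b)
  ... | tri≈ _ a≡b _ = inj₂ (inj₁ a≡b)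
  ... | tri> _ _ b<a = inj₂ (inj₂ (<⇒<ₘ b<a))

  +1-mono-<ᶠ : Formula
  +1-mono-<ᶠ = `∀ (`∀ (var 1 `< var 0 `⇒ var 1 `+ `1 `< var 0 `+ `1))

  ℕ⊨+1-mono-<ᶠ : Valid ℕ-str +1-mono-<ᶠ
  ℕ⊨+1-mono-<ᶠ _ a b a<b = <⇒<ₘ (ℕ.+-monoˡ-< 1 (<ₘ⇒< a<b))

  0<+1ᶠ : Formula
  0<+1ᶠ = `∀ (`0 `< var 0 `+ `1)

  ℕ⊨0<+1ᶠ : Valid ℕ-str 0<+1ᶠ
  ℕ⊨0<+1ᶠ _ a = <⇒<ₘ (subst (0 ℕ.<_) (ℕ.+-comm 1 a) ℕ.z<s)

  +1≤⇒≤ᶠ : Formula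
  +1≤⇒≤ᶠ = `∀ (`∀ (var 1 `+ `1 `≤ var 0 `⇒ var 1 `≤ var 0))

  ℕ⊨+1≤⇒≤ᶠ : Valid ℕ-str +1≤⇒≤ᶠ
  ℕ⊨+1≤⇒≤ᶠ _ a b a+1≤b = ℕ.≤-trans (ℕ.m≤m+n a 1) a+1≤b

  Pair-injectiveᶠ : Formula
  Pair-injectiveᶠ = `∀ (`∀ (`∀ (`∀ (`∀
    (Pairᶠ (var 4) (var 3) (var 2) `⇒ Pairᶠ (var 1) (var 0) (var 2) `⇒ var 4 `= var 1 `∧ var 3 `= var 0)))))

  ℕ⊨Pair-injectiveᶠ : Valid ℕ-str Pair-injectiveᶠ
  ℕ⊨Pair-injectiveᶠ _ l c o l′ c′ P P′ =
    pair-injective (trans (sym (Pair⇒≡pair l c {o} P)) (Pair⇒≡pair l′ c′ {o} P′))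

  unpairᶠ : Formula
  unpairᶠ = `∀ (`∃ (`∃ (Pairᶠ (var 1) (var 0) (var 2))))

  ℕ⊨unpairᶠ : Valid ℕ-str unpairᶠ
  ℕ⊨unpairᶠ _ o with pair-surjective o
  ... | l , c , refl = l , c , Pair-pair l c

  pairᶠ : Formula
  pairᶠ = `∀ (`∀ (`∃ (Pairᶠ (var 2) (var 1) (var 0))))

  ℕ⊨pairᶠ : Valid ℕ-str pairᶠ
  ℕ⊨pairᶠ _ l c = pair l c , Pair-pair l c

  Block-functionalᶠ : Formula
  Block-functionalᶠ = `∀ (`∀ (`∀ (`∀ (`∀
    (Blockᶠ (var 4) (var 3) (var 2) (var 1) `⇒ Blockᶠ (var 4) (var 3) (var 2) (var 0) `⇒ var 1 `= var 0)))))

  ℕ⊨Block-functionalᶠ : Valid ℕ-str Block-functionalᶠ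
  ℕ⊨Block-functionalᶠ _ N _ _ _ _ = NatSequences.Block-functional N

  Mem?ᶠ : Formula
  Mem?ᶠ = `∀ (`∀ (`∀ (`∀
    (Memᶠ (var 3) (var 2) (var 1) (var 0) `∨ `¬ Memᶠ (var 3) (var 2) (var 1) (var 0)))))

  ℕ⊨Mem?ᶠ : Valid ℕ-str Mem?ᶠ
  ℕ⊨Mem?ᶠ _ N = NatSequences.Mem? N

  freshᶠ : Formula
  freshᶠ = `∀ (`∀ (`∀ (`∃
    (var 2 `+ `1 `≤ var 3 `⇒ var 0 `< var 3 `∧ `¬ Memᶠ (var 3) (var 2) (var 1) (var 0)))))

  ℕ⊨freshᶠ : Valid ℕ-str freshᶠ
  ℕ⊨freshᶠ _ N = NatSequences.fresh N

  consᶠ : Formula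
  consᶠ = `∀ (`∀ (`∀ (`∀ (`∃
    (Admissibleᶠ (var 4) (var 3) (var 2) `⇒ var 1 `< var 4 `⇒ `¬ Memᶠ (var 4) (var 3) (var 2) (var 1)
     `⇒ Admissibleᶠ (var 4) (var 3 `+ `1) (var 0) `∧ Blockᶠ (var 4) (var 0) `0 (var 1)
     `∧ `∀ (`∀ (var 1 `< var 5
               `⇒ Blockᶠ (var 6) (var 4) (var 1) (var 0) `⇒ Blockᶠ (var 6) (var 2) (var 1 `+ `1) (var 0))))))))

  ℕ⊨consᶠ : Valid ℕ-str consᶠ
  ℕ⊨consᶠ _ N l c x = x ∷ᵈ c , ∷ᵈ-IsCons
    where open NatSequences N

  eval-numᵗ-ℕ : ∀ ρ k → evalT ℕ-str ρ (numᵗ k) ≡ k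
  eval-numᵗ-ℕ ρ k = trans (eval-numᵗ ℕ-str ρ k) (numeral-ℕ k)

  growthᶠ : ℕ → Formula
  growthᶠ e = `∀ (`∀ (numᵗ (K e) `≤ var 1 `⇒ var 0 `≤ powᵗ (`len (var 1)) e
    `⇒ var 0 `+ `1 `+ `1 `≤ powᵗ (`len (var 1)) e `* `len (var 1) `∧ var 0 `+ `1 `+ `1 `≤ var 1))

  ℕ⊨growthᶠ : ∀ e → Valid ℕ-str (growthᶠ e)
  ℕ⊨growthᶠ e ρ x l K≤x l≤L^e =
    subst (λ a → (l ℕ.+ 1) ℕ.+ 1 ℕ.≤ a ℕ.* ∣ x ∣ℕ) (sym L^e≡) (proj₁ bounds) , proj₂ bounds
    where
    L^e≡ : evalT ℕ-str _ (powᵗ (`len (var 1)) e) ≡ ∣ x ∣ℕ ℕ.^ e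
    L^e≡ = trans (eval-powᵗ ℕ-str (_∷ₑ_ ℕ-str l (_∷ₑ_ ℕ-str x ρ)) (`len (var 1)) e) (^ˢ-ℕ ∣ x ∣ℕ e)
    bounds = growth e (subst (ℕ._≤ x) (eval-numᵗ-ℕ _ (K e)) K≤x) (subst (l ℕ.≤_) L^e≡ l≤L^e)

  OneOfᶠ : ℕ → Formula
  OneOfᶠ zero    = `⊥
  OneOfᶠ (suc k) = var 0 `= numᵗ k `∨ OneOfᶠ k

  ℕ⊨OneOfᶠ : ∀ k ρ → ρ 0 ℕ.< k → Sat ℕ-str ρ (OneOfᶠ k)
  ℕ⊨OneOfᶠ (suc k) ρ x<1+k with ℕ.m<1+n⇒m<n∨m≡n x<1+k
  ... | inj₁ x<k = inj₂ (ℕ⊨OneOfᶠ k ρ x<k)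
  ... | inj₂ x≡k = inj₁ (trans x≡k (sym (eval-numᵗ-ℕ ρ k)))

  ≥-or-OneOfᶠ : ℕ → Formula
  ≥-or-OneOfᶠ k = `∀ (numᵗ k `≤ var 0 `∨ OneOfᶠ k)

  ℕ⊨≥-or-OneOfᶠ : ∀ k → Valid ℕ-str (≥-or-OneOfᶠ k)
  ℕ⊨≥-or-OneOfᶠ k ρ x with k ℕ.≤? x
  ... | yes k≤x = inj₁ (subst (ℕ._≤ x) (sym (eval-numᵗ-ℕ _ k)) k≤x)
  ... | no k≰x  = inj₂ (ℕ⊨OneOfᶠ k _ (ℕ.≰⇒> k≰x))

module InTrueArithmetic (𝕄 : Structure) (TA : ModelOfTrueArithmetic 𝕄) where
  open Formulas
  open StandardModel using (K)
  open Structure 𝕄 renaming (_⊕_ to infixl 6 _⊕_; _⊗_ to infixl 7 _⊗_; _≼_ to infix 4 _≼_)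
  open InModel 𝕄 renaming (_<_ to infix 4 _<ₘ_; _^ˢ_ to infixr 8 _^ˢ_)

  transfer : (φ : Formula) → Valid ℕ-str φ → Sat 𝕄 (λ _ → zer) φ
  transfer φ ℕ⊨φ = TA φ ℕ⊨φ (λ _ → zer)

  <-decᴹ : (a b : M) → a <ₘ b ⊎ ¬ a <ₘ b
  <-decᴹ = transfer <-decᶠ ℕ⊨<-decᶠ

  <-transᴹ : (a b c : M) → a <ₘ b → b <ₘ c → a <ₘ c
  <-transᴹ = transfer <-transᶠ ℕ⊨<-transᶠ

  <-trichotomyᴹ : (a b : M) → a <ₘ b ⊎ a ≡ b ⊎ b <ₘ a
  <-trichotomyᴹ = transfer <-trichotomyᶠ ℕ⊨<-trichotomyᶠ

  +1-mono-<ᴹ : (a b : M) → a <ₘ b → a ⊕ one <ₘ b ⊕ one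
  +1-mono-<ᴹ = transfer +1-mono-<ᶠ ℕ⊨+1-mono-<ᶠ

  0<+1ᴹ : (a : M) → zer <ₘ a ⊕ one
  0<+1ᴹ = transfer 0<+1ᶠ ℕ⊨0<+1ᶠ

  +1≤⇒≤ᴹ : (a b : M) → a ⊕ one ≼ b → a ≼ b
  +1≤⇒≤ᴹ = transfer +1≤⇒≤ᶠ ℕ⊨+1≤⇒≤ᶠ

  Pair-injectiveᴹ : (l c o l′ c′ : M) → Pair l c o → Pair l′ c′ o → l ≡ l′ × c ≡ c′
  Pair-injectiveᴹ = transfer Pair-injectiveᶠ ℕ⊨Pair-injectiveᶠ

  unpairᴹ : (o : M) → ∃ λ l → ∃ λ c → Pair l c o
  unpairᴹ = transfer unpairᶠ ℕ⊨unpairᶠ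

  pairᴹ : (l c : M) → ∃ λ o → Pair l c o
  pairᴹ = transfer pairᶠ ℕ⊨pairᶠ

  growthᴹ : ∀ e (x l : M) → numeral (K e) ≼ x → l ≼ bitlen x ^ˢ e
          → l ⊕ one ⊕ one ≼ bitlen x ^ˢ e ⊗ bitlen x × l ⊕ one ⊕ one ≼ x
  growthᴹ e x l K≼x l≼L^e =
    subst (λ a → l ⊕ one ⊕ one ≼ a ⊗ bitlen x) L^e≡ (proj₁ bounds) , proj₂ bounds
    where
    ρ = _∷ₑ_ 𝕄 l (_∷ₑ_ 𝕄 x (λ _ → zer))
    L^e≡ = eval-powᵗ 𝕄 ρ (`len (var 1)) e
    bounds = transfer (growthᶠ e) (ℕ⊨growthᶠ e) x l
      (subst (_≼ x) (sym (eval-numᵗ 𝕄 ρ (K e))) K≼x) (subst (l ≼_) (sym L^e≡) l≼L^e)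

  numeral≼nonstandard : ∀ {x} → Nonstandard x → ∀ k → numeral k ≼ x
  numeral≼nonstandard {x} x-nonstandard k with transfer (≥-or-OneOfᶠ k) (ℕ⊨≥-or-OneOfᶠ k) x
  ... | inj₁ k≼x   = subst (_≼ x) (eval-numᵗ 𝕄 _ k) k≼x
  ... | inj₂ x∈<k  = ⊥-elim (not-one-of k x∈<k)
    where
    not-one-of : ∀ k → ¬ Sat 𝕄 (_∷ₑ_ 𝕄 x (λ _ → zer)) (OneOfᶠ k)
    not-one-of (suc k) (inj₁ x≡k) = x-nonstandard k (trans x≡k (eval-numᵗ 𝕄 _ k))
    not-one-of (suc k) (inj₂ x∈<k) = not-one-of k x∈<k

  module _ (N : M) where
    open WithN N
    open Sequences 𝕄 N

    Block-functionalᴹ : (c i v v′ : M) → Block c i v → Block c i v′ → v ≡ v′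
    Block-functionalᴹ = transfer Block-functionalᶠ ℕ⊨Block-functionalᶠ N

    Mem?ᴹ : (l c v : M) → Mem l c v ⊎ ¬ Mem l c v
    Mem?ᴹ = transfer Mem?ᶠ ℕ⊨Mem?ᶠ N

    freshᴹ : (l c : M) → ∃ λ v → l ⊕ one ≼ N → v <ₘ N × ¬ Mem l c v
    freshᴹ = transfer freshᶠ ℕ⊨freshᶠ N

    consᴹ : (l c x : M) → ∃ λ c′ → Admissible l c → x <ₘ N → ¬ Mem l c x → IsCons l c x c′
    consᴹ = transfer consᶠ ℕ⊨consᶠ N

module MinStrategy (𝕄 : Structure) (TA : ModelOfTrueArithmetic 𝕄) (n : Structure.Carrier 𝕄)
                (n-nonstandard : InModel.Nonstandard 𝕄 n) (counting : Countable 𝕄) where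
  import Data.Nat.Properties as ℕ
  open import Data.Nat.DivMod using (m*n%n≡0)
  open import Relation.Unary using (Decidable)
  open StandardModel using (K; Least; least-below; least-below-least; Least-unique)
  open Structure 𝕄 renaming (_⊕_ to infixl 6 _⊕_; _⊗_ to infixl 7 _⊗_; _≼_ to infix 4 _≼_)
  open InModel 𝕄 renaming (_<_ to infix 4 _<ₘ_; _^ˢ_ to infixr 8 _^ˢ_)
  open WithN n
  open Sequences 𝕄 n
  open InTrueArithmetic 𝕄 TA

  enum : ℕ → M
  enum = proj₁ counting

  index : M → ℕ
  index a = proj₁ (proj₂ counting a)

  enum-index : ∀ a → enum (index a) ≡ a
  enum-index a = proj₂ (proj₂ counting a)

  len code : M → M
  len o = proj₁ (unpairᴹ o)
  code o = proj₁ (proj₂ (unpairᴹ o))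

  IsSeq⇒decoded : ∀ {o l c} → IsSeq o l c → l ≡ len o × c ≡ code o
  IsSeq⇒decoded {o} {l} {c} (P , _) = Pair-injectiveᴹ l c o (len o) (code o) P (proj₂ (proj₂ (unpairᴹ o)))

  record Decoded (o : M) : Set where
    field
      isSeq      : IsSeq o (len o) (code o)
      admissible : Admissible (len o) (code o)
      exponent   : ℕ
      short      : len o ≼ W ^ˢ exponent

  decode : ∀ {o} → IsO o → Decoded o
  decode (l , c , S , distinct , bounded , e , l≼W^e) with IsSeq⇒decoded S
  ... | refl , refl = record
    { isSeq = S ; admissible = proj₂ S , distinct , bounded ; exponent = e ; short = l≼W^e }

  Before : M → M → M → M → Set
  Before l c a b = ∃ λ i → ∃ λ j → i <ₘ j × j <ₘ l × Block c i a × Block c j b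

  ◁⇒Before : ∀ {o a b} → a ◁[ o ] b → Before (len o) (code o) a b
  ◁⇒Before (l , c , i , j , S , i<j , j<l , Ba , Bb) with IsSeq⇒decoded S
  ... | refl , refl = i , j , i<j , j<l , Ba , Bb

  Before⇒◁ : ∀ {o l c a b} → IsSeq o l c → Before l c a b → a ◁[ o ] b
  Before⇒◁ {l = l} {c} S (i , j , i<j , j<l , Ba , Bb) = l , c , i , j , S , i<j , j<l , Ba , Bb

  Before⇒Mem : ∀ {l c a b} → Before l c a b → Mem l c a × Mem l c b
  Before⇒Mem {l} (i , j , i<j , j<l , Ba , Bb) = (i , <-transᴹ i j l i<j j<l , Ba) , (j , j<l , Bb)

  module _ {l c} (distinct : Distinct l c) where

    Before-irreflexive : ∀ {a} → ¬ Before l c a a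
    Before-irreflexive (i , j , i<j , j<l , Ba , Ba′) =
      proj₂ i<j (distinct i j _ (<-transᴹ i j l i<j j<l) j<l Ba Ba′)

    Before-transitive : ∀ {a b d} → Before l c a b → Before l c b d → Before l c a d
    Before-transitive (i , j , i<j , j<l , Ba , Bb) (j′ , k , j′<k , k<l , Bb′ , Bd)
      with distinct j j′ _ j<l (<-transᴹ j′ k l j′<k k<l) Bb Bb′
    ... | refl = i , k , <-transᴹ i j k i<j j′<k , k<l , Ba , Bd

  Before-total : ∀ {l c a b} → Mem l c a → Mem l c b → Before l c a b ⊎ a ≡ b ⊎ Before l c b a
  Before-total {c = c} (i , i<l , Ba) (j , j<l , Bb) with <-trichotomyᴹ i j
  ... | inj₁ i<j         = inj₁ (i , j , i<j , j<l , Ba , Bb)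
  ... | inj₂ (inj₁ refl) = inj₂ (inj₁ (Block-functionalᴹ n c i _ _ Ba Bb))
  ... | inj₂ (inj₂ j<i)  = inj₂ (inj₂ (j , i , j<i , i<l , Bb , Ba))

  module _ {l c x c′} (cons : IsCons l c x c′) where

    Before-IsCons : ∀ {a b} → Before l c a b → Before (l ⊕ one) c′ a b
    Before-IsCons (i , j , i<j , j<l , Ba , Bb) =
      i ⊕ one , j ⊕ one , +1-mono-<ᴹ i j i<j , +1-mono-<ᴹ j l j<l ,
      proj₂ (proj₂ cons) i _ (<-transᴹ i j l i<j j<l) Ba , proj₂ (proj₂ cons) j _ j<l Bb

    Mem-IsCons-head : Mem (l ⊕ one) c′ x
    Mem-IsCons-head = zer , 0<+1ᴹ l , proj₁ (proj₂ cons)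

    Before-IsCons-head : ∀ {a} → Mem l c a → Before (l ⊕ one) c′ x a
    Before-IsCons-head (i , i<l , Ba) =
      zer , i ⊕ one , 0<+1ᴹ i , +1-mono-<ᴹ i l i<l , proj₁ (proj₂ cons) , proj₂ (proj₂ cons) i _ i<l Ba

  Missing : M → ℕ → Set
  Missing o j = enum j <ₘ n × ¬ Mem (len o) (code o) (enum j)

  Missing? : ∀ o → Decidable (Missing o)
  Missing? o j with <-decᴹ (enum j) n | Mem?ᴹ n (len o) (code o) (enum j)
  ... | inj₁ j<n | inj₂ j∉o = yes (j<n , j∉o)
  ... | inj₁ _   | inj₁ j∈o = no λ (_ , j∉o) → j∉o j∈o
  ... | inj₂ j≮n | _        = no λ (j<n , _) → j≮n j<n

  spare : M → M
  spare o = proj₁ (freshᴹ n (len o) (code o))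

  -- The search is bounded by the index of a spare element; it succeeds whenever o ∈ 𝕆, and
  -- its value is junk otherwise.
  first : M → ℕ
  first o = least-below (Missing? o) (suc (index (spare o)))

  new : M → M
  new o = enum (first o)

  code₁ : M → M
  code₁ o = proj₁ (consᴹ n (len o) (code o) (new o))

  below : M → M
  below o = proj₁ (freshᴹ n (len o ⊕ one) (code₁ o))

  code₂ : M → M
  code₂ o = proj₁ (consᴹ n (len o ⊕ one) (code₁ o) (below o))

  -- `below o` puts `new o` into the field of ◁: an extension only has to keep the order, so
  -- an entry related to nothing could be dropped by the other players.
  𝒮 : M → M
  𝒮 o = proj₁ (pairᴹ (len o ⊕ one ⊕ one) (code₂ o))

  module Move {o} (o∈𝕆 : IsO o) where
    open Decoded (decode o∈𝕆)

    room : len o ⊕ one ⊕ one ≼ W ^ˢ exponent ⊗ W × len o ⊕ one ⊕ one ≼ n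
    room = growthᴹ exponent n (len o) (numeral≼nonstandard n-nonstandard (K exponent)) short

    first-least : Least (Missing? o) (first o)
    first-least = least-below-least (Missing? o) spare-missing (ℕ.n<1+n _)
      where
      spare-missing : Missing o (index (spare o))
      spare-missing = subst (λ a → a <ₘ n × ¬ Mem (len o) (code o) a) (sym (enum-index (spare o)))
        (proj₂ (freshᴹ n (len o) (code o)) (+1≤⇒≤ᴹ (len o ⊕ one) n (proj₂ room)))

    cons₁ : IsCons (len o) (code o) (new o) (code₁ o)
    cons₁ = let new<n , new∉o = proj₁ first-least in
      proj₂ (consᴹ n (len o) (code o) (new o)) admissible new<n new∉o

    cons₂ : IsCons (len o ⊕ one) (code₁ o) (below o) (code₂ o)
    cons₂ = let below<n , below∉o₁ = proj₂ (freshᴹ n (len o ⊕ one) (code₁ o)) (proj₂ room) in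
      proj₂ (consᴹ n (len o ⊕ one) (code₁ o) (below o)) (proj₁ cons₁) below<n below∉o₁

    isSeq′ : IsSeq (𝒮 o) (len o ⊕ one ⊕ one) (code₂ o)
    isSeq′ = proj₂ (pairᴹ (len o ⊕ one ⊕ one) (code₂ o)) , proj₁ (proj₁ cons₂)

    𝒮-IsO : IsO (𝒮 o)
    𝒮-IsO = let _ , distinct , bounded = proj₁ cons₂ in
      _ , _ , isSeq′ , distinct , bounded , suc exponent , proj₁ room

    𝒮-extends : 𝒮 o ⪯ o
    𝒮-extends a b a◁b = Before⇒◁ isSeq′ (Before-IsCons cons₂ (Before-IsCons cons₁ (◁⇒Before a◁b)))

    below◁new : below o ◁[ 𝒮 o ] new o
    below◁new = Before⇒◁ isSeq′ (Before-IsCons-head cons₂ (Mem-IsCons-head cons₁))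

    new◁entry : ∀ {a} → Mem (len o) (code o) a → new o ◁[ 𝒮 o ] a
    new◁entry a∈o = Before⇒◁ isSeq′ (Before-IsCons cons₂ (Before-IsCons-head cons₁ a∈o))

  Listed : M → M → Set
  Listed o a = ∃ λ b → a ◁[ o ] b ⊎ b ◁[ o ] a

  Listed-⪯ : ∀ {o o′ a} → o′ ⪯ o → Listed o a → Listed o′ a
  Listed-⪯ o′⪯o (b , inj₁ a◁b) = b , inj₁ (o′⪯o _ b a◁b)
  Listed-⪯ o′⪯o (b , inj₂ b◁a) = b , inj₂ (o′⪯o b _ b◁a)

  Listed⇒Mem : ∀ {o a} → Listed o a → Mem (len o) (code o) a
  Listed⇒Mem (b , inj₁ a◁b) = proj₁ (Before⇒Mem (◁⇒Before a◁b))
  Listed⇒Mem (b , inj₂ b◁a) = proj₂ (Before⇒Mem (◁⇒Before b◁a))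

  𝒮-lists : ∀ {o j} → IsO o → (∀ {k} → k ℕ.< j → ¬ Missing o k) → enum j <ₘ n → Listed (𝒮 o) (enum j)
  𝒮-lists {o} {j} o∈𝕆 earlier-unmissing j<n = [ present , absent ]′ (Mem?ᴹ n (len o) (code o) (enum j))
    where
    present : Mem (len o) (code o) (enum j) → Listed (𝒮 o) (enum j)
    present j∈o = new o , inj₂ (Move.new◁entry o∈𝕆 j∈o)
    absent : ¬ Mem (len o) (code o) (enum j) → Listed (𝒮 o) (enum j)
    absent j∉o = subst (λ k → Listed (𝒮 o) (enum k)) first≡j (below o , inj₂ (Move.below◁new o∈𝕆))
      where
      first≡j : first o ≡ j
      first≡j = Least-unique (Missing? o) (Move.first-least o∈𝕆) ((j<n , j∉o) , earlier-unmissing)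

  module Play (o : ℕ → M) (play : PlayFollowing 𝒮 o) where

    o∈𝕆 : ∀ k → IsO (o k)
    o∈𝕆 = proj₁ (proj₂ play)

    o-⪯′ : ∀ {k k′} → k ℕ.≤′ k′ → o k′ ⪯ o k
    o-⪯′ ℕ.≤′-refl          a b a◁b = a◁b
    o-⪯′ (ℕ.≤′-step k≤′k′) a b a◁b = proj₁ (proj₂ (proj₂ play)) _ a b (o-⪯′ k≤′k′ a b a◁b)

    o-⪯ : ∀ {k k′} → k ℕ.≤ k′ → o k′ ⪯ o k
    o-⪯ k≤k′ = o-⪯′ (ℕ.≤⇒≤′ k≤k′)

    MIN-moves : ∀ m → o (suc (m ℕ.* 3)) ≡ 𝒮 (o (m ℕ.* 3))
    MIN-moves m = proj₂ (proj₂ (proj₂ play)) (m ℕ.* 3) (m*n%n≡0 m 3)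

    listed-after-stage : ∀ m → (∀ {k} → k ℕ.< m → enum k <ₘ n → Listed (o (m ℕ.* 3)) (enum k))
                       → enum m <ₘ n → Listed (o (suc m ℕ.* 3)) (enum m)
    listed-after-stage m listed-before m<n = Listed-⪯ (o-⪯ (ℕ.m≤n+m (suc (m ℕ.* 3)) 2))
      (subst (λ o′ → Listed o′ (enum m)) (sym (MIN-moves m)) (𝒮-lists (o∈𝕆 (m ℕ.* 3)) earlier-unmissing m<n))
      where
      earlier-unmissing : ∀ {k} → k ℕ.< m → ¬ Missing (o (m ℕ.* 3)) k
      earlier-unmissing k<m (k<n , k∉o) = k∉o (Listed⇒Mem (listed-before k<m k<n))

    enum-listed : ∀ m {j} → j ℕ.< m → enum j <ₘ n → Listed (o (m ℕ.* 3)) (enum j)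
    enum-listed (suc m) {j} j<1+m j<n = [ listed-earlier , listed-now ]′ (ℕ.m<1+n⇒m<n∨m≡n j<1+m)
      where
      listed-earlier : j ℕ.< m → Listed (o (suc m ℕ.* 3)) (enum j)
      listed-earlier j<m = Listed-⪯ (o-⪯ (ℕ.m≤n+m (m ℕ.* 3) 3)) (enum-listed m j<m j<n)
      listed-now : j ≡ m → Listed (o (suc m ℕ.* 3)) (enum j)
      listed-now refl = listed-after-stage j (enum-listed j) j<n

    R : M → M → Set
    R = PlayRel o

    R-field : ∀ a b → R a b → a <ₘ n × b <ₘ n
    R-field a b (k , a◁b) with ◁⇒Before a◁b | decode (o∈𝕆 k)
    ... | i , j , i<j , j<l , Ba , Bb | record { admissible = _ , _ , bounded } =
      bounded i a (<-transᴹ i j _ i<j j<l) Ba , bounded j b j<l Bb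

    R-irreflexive : ∀ a → ¬ R a a
    R-irreflexive a (k , a◁a) = Before-irreflexive distinct (◁⇒Before a◁a)
      where open Decoded (decode (o∈𝕆 k)) using (admissible)
            distinct = proj₁ (proj₂ admissible)

    R-transitive : ∀ a b d → R a b → R b d → R a d
    R-transitive a b d (k₁ , a◁b) (k₂ , b◁d) = k , Before⇒◁ isSeq
      (Before-transitive (proj₁ (proj₂ admissible)) (at-k (ℕ.m≤m+n k₁ k₂) a◁b) (at-k (ℕ.m≤n+m k₂ k₁) b◁d))
      where
      k = k₁ ℕ.+ k₂
      open Decoded (decode (o∈𝕆 k))
      at-k : ∀ {k′ x y} → k′ ℕ.≤ k → x ◁[ o k′ ] y → Before (len (o k)) (code (o k)) x y
      at-k k′≤k x◁y = ◁⇒Before (o-⪯ k′≤k _ _ x◁y)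

    Mem-at : ℕ → M → Set
    Mem-at k a = Mem (len (o k)) (code (o k)) a

    Mem-at-stage : ∀ m a → index a ℕ.< m → a <ₘ n → Mem-at (m ℕ.* 3) a
    Mem-at-stage m a a<m a<n = subst (Mem-at (m ℕ.* 3)) (enum-index a)
      (Listed⇒Mem (enum-listed m a<m (subst (_<ₘ n) (sym (enum-index a)) a<n)))

    R-total-at : ∀ k {a b} → Mem-at k a → Mem-at k b → R a b ⊎ a ≡ b ⊎ R b a
    R-total-at k a∈o b∈o with Before-total a∈o b∈o
    ... | inj₁ a<b         = inj₁ (k , Before⇒◁ (Decoded.isSeq (decode (o∈𝕆 k))) a<b)
    ... | inj₂ (inj₁ a≡b)  = inj₂ (inj₁ a≡b)
    ... | inj₂ (inj₂ b<a)  = inj₂ (inj₂ (k , Before⇒◁ (Decoded.isSeq (decode (o∈𝕆 k))) b<a))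

    R-total : ∀ a b → a <ₘ n → b <ₘ n → R a b ⊎ a ≡ b ⊎ R b a
    R-total a b a<n b<n = R-total-at (m ℕ.* 3)
      (Mem-at-stage m a (ℕ.s≤s (ℕ.m≤m+n (index a) (index b))) a<n)
      (Mem-at-stage m b (ℕ.s≤s (ℕ.m≤n+m (index b) (index a))) b<n)
      where m = suc (index a ℕ.+ index b)

    R-no-least : ∀ a → a <ₘ n → ∃ λ b → R b a
    R-no-least a a<n = new (o stage) , suc stage ,
      subst (λ o′ → new (o stage) ◁[ o′ ] a) (sym (MIN-moves (suc (index a))))
        (Move.new◁entry (o∈𝕆 stage) (Mem-at-stage (suc (index a)) a (ℕ.n<1+n (index a)) a<n))
      where stage = suc (index a) ℕ.* 3

    win : StrictLinearNoLeast R
    win = R-field , R-irreflexive , R-transitive , R-total , R-no-least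

  𝒮-Strategy : Strategy 𝒮
  𝒮-Strategy o o∈𝕆 = Move.𝒮-IsO o∈𝕆 , Move.𝒮-extends o∈𝕆

  𝒮-Winning : Winning 𝒮
  𝒮-Winning = Play.win

proposition3p3 : (𝕄 : Structure) → ModelOfTrueArithmetic 𝕄 → Countable 𝕄
    → (n : Structure.Carrier 𝕄) → InModel.Nonstandard 𝕄 n
    → Σ (Structure.Carrier 𝕄 → Structure.Carrier 𝕄)
        (λ 𝒮 → InModel.WithN.Strategy 𝕄 n 𝒮 × InModel.WithN.Winning 𝕄 n 𝒮)
proposition3p3 𝕄 TA counting n n-nonstandard = 𝒮 , 𝒮-Strategy , 𝒮-Winning
  where open MinStrategy 𝕄 TA n n-nonstandard counting
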